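{- Let $n\ge1$, $x,y$ coprime with $1\le x<y$, and $F=\sum_{i=0}^n x^{n-i}y^i$. For any integer $v\ge0$, the map $k\mapsto c[v+kF]_{n+1}$, for $k\in\mathbb{N}$, is nondecreasing, where $c[w]_{n+1}$ denotes the last coordinate of the stable decomposition $c[w]$.
   Context: Let $d_k=x^{n-k}y^k$ for $0\le k\le n+1$. For an integer $w\ge0$, its stable decomposition $c[w]=(c_0,\dots,c_{n+1})$ is the unique tuple with $w=\sum_{k=0}^{n+1}c_kd_k$, $c_k\in\{0,\dots,y-1\}$ for $0\le k\le n$ and $c_{n+1}\in x\mathbb{Z}$. -}

module Defs where

open import Data.Nat as ℕ using (ℕ; zero; suc; _∸_; _^_)
open import Data.Fin using (Fin; zero; suc; toℕ; inject₁; fromℕ)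
open import Data.Integer as ℤ using (ℤ; +_; 0ℤ; _+_; _*_; _≤_; _<_)
open import Data.Integer.Divisibility using (_∣_)
open import Data.Product using (_×_)
open import Relation.Binary.PropositionalEquality using (_≡_)

sumFin : ∀ {m} → (Fin m → ℤ) → ℤ
sumFin {zero}  f = 0ℤ
sumFin {suc m} f = f zero + sumFin (λ i → f (suc i))

d : (x y n k : ℕ) → ℤ
d x y n k = + (x ^ (n ∸ k) ℕ.* y ^ k)

F : (x y n : ℕ) → ℤ
F x y n = sumFin {suc n} (λ i → d x y n (toℕ i))

last : (n : ℕ) → Fin (suc (suc n))
last n = fromℕ (suc n)

-- c = (c_0,…,c_{n+1}) is the stable decomposition of w:
--   0 ≤ c_k ≤ y-1 for k ≤ n,  c_{n+1} ∈ xℤ,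
--   w = Σ_{k≤n} c_k x^(n-k) y^k + c_{n+1} · x^(-1) y^(n+1)
-- the last equation is stated after multiplying through by x (x ≥ 1).
IsStableDecomp : (x y n : ℕ) → ℤ → (Fin (suc (suc n)) → ℤ) → Set
IsStableDecomp x y n w c =
  ((k : Fin (suc n)) → (0ℤ ≤ c (inject₁ k)) × (c (inject₁ k) < + y)) ×
  ((+ x) ∣ c (last n)) ×
  ((+ x) * w ≡ (+ x) * sumFin (λ (k : Fin (suc n)) → c (inject₁ k) * d x y n (toℕ k))
               + c (last n) * + (y ^ suc n))

{-# OPTIONS --safe #-}
module Submission where

-- Compare two expansions of the same integer, one with arbitrary nonnegative
-- coefficients a_k and one with digits b_k ∈ [0, y). At position 0 the weight
-- x^(n+1) is coprime to y, so a_0 ≡ b_0 (mod y), i.e. a_0 = b_0 + q·y with q ≥ 0;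
-- the surplus q·y·x^(n+1) is carried to position 1 as q·x·x^n. Carrying up to the
-- top shows that the digit expansion has the larger top coefficient. Adding m·F
-- to w adds m to every c_k with k ≤ n, so with m = k′ − k this gives the theorem.

open import Defs
open import Data.Nat using (ℕ; suc; _≥_)
open import Data.Nat.Coprimality using (Coprime)
open import Data.Fin using (Fin)
open import Data.Integer using (ℤ; +_; _+_; _*_; _≤_)

open import Data.Nat as ℕ using (zero; _∸_; _^_; z≤n; >-nonZero)
import Data.Nat.Properties as ℕ
import Data.Nat.Coprimality as ℕ using (sym)
open import Data.Nat.DivMod using (_%_; _/_; m≡m%n+[m/n]*n; m%n<n; m<n⇒m%n≡m)
open import Data.Nat.Divisibility using (n∣m⇒m%n≡0; m∣m*n) renaming (_∣_ to _∣ℕ_)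
open import Data.Integer using (0ℤ; _-_; _⊖_; ∣_∣; _<_; +≤+; +<+)
open import Data.Integer.Properties
import Algebra.Properties.CommutativeSemigroup as CommSemigroupProperties
open CommSemigroupProperties *-commutativeSemigroup using (x∙yz≈y∙xz)
open import Data.Integer.Divisibility using (_∣_)
open import Data.Integer.Coprimality using (coprime-divisor)
open import Data.Integer.Tactic.RingSolver using (solve-∀)
open import Data.Fin using (zero; suc; toℕ; inject₁)
open import Data.Fin.Properties using (toℕ≤pred[n])
open import Data.Product using (∃-syntax; _×_; _,_; proj₁; proj₂)
open import Function using (_∘_)
open import Relation.Binary.PropositionalEquality

sumFin-cong : ∀ {m} {f g : Fin m → ℤ} → (∀ i → f i ≡ g i) → sumFin f ≡ sumFin g
sumFin-cong {zero}  f≗g = refl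
sumFin-cong {suc m} f≗g = cong₂ _+_ (f≗g zero) (sumFin-cong (f≗g ∘ suc))

*-distribˡ-sumFin : ∀ {m} c (f : Fin m → ℤ) → c * sumFin f ≡ sumFin (λ i → c * f i)
*-distribˡ-sumFin {zero}  c f = *-zeroʳ c
*-distribˡ-sumFin {suc m} c f = begin
  c * (f zero + sumFin (f ∘ suc))        ≡⟨ *-distribˡ-+ c (f zero) _ ⟩
  c * f zero + c * sumFin (f ∘ suc)      ≡⟨ cong (_+_ (c * f zero)) (*-distribˡ-sumFin c (f ∘ suc)) ⟩
  c * f zero + sumFin (λ i → c * f (suc i)) ∎
  where open ≡-Reasoning

sumFin-+ : ∀ {m} (f g : Fin m → ℤ) → sumFin (λ i → f i + g i) ≡ sumFin f + sumFin g
sumFin-+ {zero}  f g = refl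
sumFin-+ {suc m} f g = begin
  (f zero + g zero) + sumFin (λ i → f (suc i) + g (suc i))  ≡⟨ cong (_+_ (f zero + g zero)) (sumFin-+ (f ∘ suc) (g ∘ suc)) ⟩
  (f zero + g zero) + (sumFin (f ∘ suc) + sumFin (g ∘ suc)) ≡⟨ +-interchange (f zero) (g zero) _ _ ⟩
  (f zero + sumFin (f ∘ suc)) + (g zero + sumFin (g ∘ suc)) ∎
  where
  open ≡-Reasoning
  +-interchange : ∀ a b c e → (a + b) + (c + e) ≡ (a + c) + (b + e)
  +-interchange = solve-∀

module _ (x y : ℕ) where

  d-zero : ∀ n → d x y n 0 ≡ + (x ^ n)
  d-zero n = cong +_ (ℕ.*-identityʳ (x ^ n))

  d-suc-suc : ∀ n k → d x y (suc n) (suc k) ≡ + y * d x y n k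
  d-suc-suc n k = trans (cong +_ (CommSemigroupProperties.x∙yz≈y∙xz ℕ.*-commutativeSemigroup (x ^ (n ∸ k)) y (y ^ k))) (pos-* y _)

  d-exponent-suc : ∀ {n k} → k ℕ.≤ n → d x y (suc n) k ≡ + x * d x y n k
  d-exponent-suc {n} {k} k≤n = begin
    + (x ^ (suc n ∸ k) ℕ.* y ^ k)      ≡⟨ cong (λ e → + (x ^ e ℕ.* y ^ k)) (ℕ.+-∸-assoc 1 k≤n) ⟩
    + (x ℕ.* x ^ (n ∸ k) ℕ.* y ^ k)    ≡⟨ cong +_ (ℕ.*-assoc x _ _) ⟩
    + (x ℕ.* (x ^ (n ∸ k) ℕ.* y ^ k))  ≡⟨ pos-* x _ ⟩
    + x * d x y n k                    ∎
    where open ≡-Reasoning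

  weightedSum : (n : ℕ) {ℓ : ℕ} → (Fin ℓ → ℤ) → ℤ
  weightedSum n a = sumFin (λ k → a k * d x y n (toℕ k))

  expansion : (n : ℕ) → (Fin n → ℤ) → ℤ → ℤ
  expansion n a C = weightedSum n a + C * + (y ^ n)

  weightedSum-exponent-suc : ∀ n (a : Fin (suc n) → ℤ) → weightedSum (suc n) a ≡ + x * weightedSum n a
  weightedSum-exponent-suc n a =
    trans (sumFin-cong λ k → trans (cong (a k *_) (d-exponent-suc (toℕ≤pred[n] k)))
                                   (x∙yz≈y∙xz (a k) (+ x) _))
          (sym (*-distribˡ-sumFin (+ x) (λ k → a k * d x y n (toℕ k))))

  weightedSum-+-const : ∀ n {ℓ} (a : Fin ℓ → ℤ) m →
    weightedSum n (λ k → a k + + m) ≡ weightedSum n a + + m * sumFin {ℓ} (λ k → d x y n (toℕ k))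
  weightedSum-+-const n {ℓ} a m = begin
    sumFin (λ k → (a k + + m) * d x y n (toℕ k))
      ≡⟨ sumFin-cong (λ k → *-distribʳ-+ (d x y n (toℕ k)) (a k) (+ m)) ⟩
    sumFin (λ k → a k * d x y n (toℕ k) + + m * d x y n (toℕ k))
      ≡⟨ sumFin-+ {ℓ} (λ k → a k * d x y n (toℕ k)) (λ k → + m * d x y n (toℕ k)) ⟩
    weightedSum n a + sumFin {ℓ} (λ k → + m * d x y n (toℕ k))
      ≡⟨ cong (_+_ (weightedSum n a)) (*-distribˡ-sumFin {ℓ} (+ m) (λ k → d x y n (toℕ k))) ⟨
    weightedSum n a + + m * sumFin {ℓ} (λ k → d x y n (toℕ k))
      ∎
    where open ≡-Reasoning

  expansion-suc : ∀ n (a : Fin (suc n) → ℤ) C →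
              expansion (suc n) a C ≡ a zero * + (x ^ suc n) + + y * expansion n (a ∘ suc) C
  expansion-suc n a C = begin
    a zero * d x y (suc n) 0 + sumFin tail + C * + (y ^ suc n)
      ≡⟨ cong₂ (λ s t → a zero * s + sumFin tail + C * t) (d-zero (suc n)) (pos-* y (y ^ n)) ⟩
    a zero * + (x ^ suc n) + sumFin tail + C * (+ y * + (y ^ n))
      ≡⟨ cong (λ s → a zero * + (x ^ suc n) + s + C * (+ y * + (y ^ n))) tail≡ ⟩
    a zero * + (x ^ suc n) + + y * weightedSum n (a ∘ suc) + C * (+ y * + (y ^ n))
      ≡⟨ regroup (a zero * + (x ^ suc n)) (+ y) (weightedSum n (a ∘ suc)) C (+ (y ^ n)) ⟩
    a zero * + (x ^ suc n) + + y * expansion n (a ∘ suc) C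
      ∎
    where
    open ≡-Reasoning
    tail : Fin n → ℤ
    tail k = a (suc k) * d x y (suc n) (suc (toℕ k))
    tail≡ : sumFin tail ≡ + y * weightedSum n (a ∘ suc)
    tail≡ = trans (sumFin-cong λ k → trans (cong (a (suc k) *_) (d-suc-suc n (toℕ k)))
                                            (x∙yz≈y∙xz (a (suc k)) (+ y) _))
                  (sym (*-distribˡ-sumFin (+ y) (λ k → a (suc k) * d x y n (toℕ k))))
    regroup : ∀ h Y S C Yⁿ → h + Y * S + C * (Y * Yⁿ) ≡ h + Y * (S + C * Yⁿ)
    regroup = solve-∀

  expansion-shift : ∀ n (c : Fin (suc n) → ℤ) C w m →
    + x * w ≡ + x * weightedSum n c + C * + (y ^ suc n) →
    expansion (suc n) (λ i → c i + + m) C ≡ + x * (w + + m * F x y n)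
  expansion-shift n c C w m w-sum = begin
    weightedSum (suc n) (λ i → c i + + m) + C * Y
      ≡⟨ cong (_+ C * Y) (weightedSum-exponent-suc n (λ i → c i + + m)) ⟩
    + x * weightedSum n (λ i → c i + + m) + C * Y
      ≡⟨ cong (λ s → + x * s + C * Y) (weightedSum-+-const n c m) ⟩
    + x * (weightedSum n c + + m * F x y n) + C * Y
      ≡⟨ regroup (+ x) (weightedSum n c) (+ m * F x y n) (C * Y) ⟩
    (+ x * weightedSum n c + C * Y) + + x * (+ m * F x y n)
      ≡⟨ cong (_+ + x * (+ m * F x y n)) w-sum ⟨
    + x * w + + x * (+ m * F x y n)
      ≡⟨ *-distribˡ-+ (+ x) w _ ⟨
    + x * (w + + m * F x y n)
      ∎
    where
    open ≡-Reasoning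
    Y = + (y ^ suc n)
    regroup : ∀ X S T U → X * (S + T) + U ≡ (X * S + U) + X * T
    regroup = solve-∀

∣i∣<n∧n∣i⇒i≡0 : ∀ {n i} → ∣ i ∣ ℕ.< n → + n ∣ i → i ≡ 0ℤ
∣i∣<n∧n∣i⇒i≡0 {suc _} {i} ∣i∣<n n∣i = ∣i∣≡0⇒i≡0 (begin
  ∣ i ∣         ≡⟨ m<n⇒m%n≡m ∣i∣<n ⟨
  ∣ i ∣ % _     ≡⟨ n∣m⇒m%n≡0 ∣ i ∣ _ n∣i ⟩
  0             ∎)
  where open ≡-Reasoning

∣m-n∣<o : ∀ {m n o} → m ℕ.< o → n ℕ.< o → ∣ + m - + n ∣ ℕ.< o
∣m-n∣<o {m} {n} m<o n<o = begin-strict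
  ∣ + m - + n ∣ ≡⟨ cong ∣_∣ (m-n≡m⊖n m n) ⟩
  ∣ m ⊖ n ∣     ≤⟨ ∣m⊝n∣≤m⊔n m n ⟩
  m ℕ.⊔ n       <⟨ ℕ.⊔-pres-<m m<o n<o ⟩
  _             ∎
  where open ℕ.≤-Reasoning

module _ {x y : ℕ} (coprime : Coprime y x) where

  coprime-divisor-^ : ∀ j {z} → + y ∣ + (x ^ j) * z → + y ∣ z
  coprime-divisor-^ zero    {z} y∣z = subst (+ y ∣_) (*-identityˡ z) y∣z
  coprime-divisor-^ (suc j) {z} y∣xʲ⁺¹z =
    coprime-divisor-^ j (coprime-divisor (+ y) (+ x) _ coprime
      (subst (+ y ∣_) xʲ⁺¹z≡x[xʲz] y∣xʲ⁺¹z))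
    where
    xʲ⁺¹z≡x[xʲz] : + (x ^ suc j) * z ≡ + x * (+ (x ^ j) * z)
    xʲ⁺¹z≡x[xʲz] = trans (cong (_* z) (pos-* x (x ^ j))) (*-assoc (+ x) (+ (x ^ j)) z)

  digit-carry : ∀ j {a b R R′} → 0ℤ ≤ a → 0ℤ ≤ b → b < + y →
                a * + (x ^ j) + + y * R ≡ b * + (x ^ j) + + y * R′ →
                ∃[ q ] R + + q * + (x ^ j) ≡ R′
  digit-carry j {R = R} {R′} (+≤+ {n = A} _) (+≤+ {n = B} _) (+<+ B<y) eq = q , carried
    where
    instance _ = >-nonZero (ℕ.≤-<-trans z≤n B<y)
    X = + (x ^ j)
    Y = + y
    r = A % y
    q = A / y
    A≡r+qy : + A ≡ + r + + q * Y
    A≡r+qy = begin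
      + A                ≡⟨ cong +_ (m≡m%n+[m/n]*n A y) ⟩
      + (r ℕ.+ q ℕ.* y)  ≡⟨ pos-+ r (q ℕ.* y) ⟩
      + r + + (q ℕ.* y)  ≡⟨ cong (λ t → + r + t) (pos-* q y) ⟩
      + r + + q * Y      ∎
      where open ≡-Reasoning
    eq′ : (+ r + + q * Y) * X + Y * R ≡ + B * X + Y * R′
    eq′ = subst (λ a → a * X + Y * R ≡ + B * X + Y * R′) A≡r+qy eq
    W = R′ - R - + q * X
    xʲ[r-B]≡yW : X * (+ r - + B) ≡ Y * W
    xʲ[r-B]≡yW = begin
      X * (+ r - + B)                                             ≡⟨ lhs-rhs-split (+ r) (+ q) Y X R (+ B) R′ ⟩
      ((+ r + + q * Y) * X + Y * R) - (+ B * X + Y * R′) + Y * W  ≡⟨ cong (λ e → e - (+ B * X + Y * R′) + Y * W) eq′ ⟩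
      (+ B * X + Y * R′) - (+ B * X + Y * R′) + Y * W             ≡⟨ cancel (+ B * X + Y * R′) (Y * W) ⟩
      Y * W                                                       ∎
      where
      open ≡-Reasoning
      lhs-rhs-split : ∀ r q Y X R B R′ →
        X * (r - B) ≡ ((r + q * Y) * X + Y * R) - (B * X + Y * R′) + Y * (R′ - R - q * X)
      lhs-rhs-split = solve-∀
      cancel : ∀ e f → e - e + f ≡ f
      cancel = solve-∀
    r≡B : + r ≡ + B
    r≡B = i-j≡0⇒i≡j (+ r) (+ B) (∣i∣<n∧n∣i⇒i≡0 (∣m-n∣<o (m%n<n A y) B<y)
      (coprime-divisor-^ j (subst (+ y ∣_) (sym xʲ[r-B]≡yW)
        (subst (y ∣ℕ_) (sym (abs-* Y W)) (m∣m*n ∣ W ∣)))))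
    carried : R + + q * X ≡ R′
    carried = *-cancelˡ-≡ Y _ _ (begin
      Y * (R + + q * X)                      ≡⟨ regroup (+ B) (+ q) Y X R ⟩
      ((+ B + + q * Y) * X + Y * R) - + B * X ≡⟨ cong (λ a → ((a + + q * Y) * X + Y * R) - + B * X) r≡B ⟨
      ((+ r + + q * Y) * X + Y * R) - + B * X ≡⟨ cong (_- + B * X) eq′ ⟩
      (+ B * X + Y * R′) - + B * X           ≡⟨ cancel (+ B * X) (Y * R′) ⟩
      Y * R′                                 ∎)
      where
      open ≡-Reasoning
      regroup : ∀ B q Y X R → Y * (R + q * X) ≡ ((B + q * Y) * X + Y * R) - B * X
      regroup = solve-∀
      cancel : ∀ e f → (e + f) - e ≡ f
      cancel = solve-∀

  -- q is a carry still to be added at position 0; it keeps the induction going.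
  expansion-top-≤ : ∀ n (a b : Fin n → ℤ) → (∀ i → 0ℤ ≤ a i) → (∀ i → 0ℤ ≤ b i × b i < + y) →
                     ∀ q {C C′} → expansion x y n a C + + q * + (x ^ n) ≡ expansion x y n b C′ → C ≤ C′
  expansion-top-≤ zero a b _ _ q {C} {C′} eq =
    subst (C ≤_) (trans (unfold-lhs C (+ q)) (trans eq (unfold-rhs C′))) (i≤i+j C (+ q))
    where
    unfold-lhs : ∀ C q → C + q ≡ 0ℤ + C * + 1 + q * + 1
    unfold-lhs = solve-∀
    unfold-rhs : ∀ C → 0ℤ + C * + 1 ≡ C
    unfold-rhs = solve-∀
  expansion-top-≤ (suc n) a b a≥0 b-digit q {C} {C′} eq
    with digit-carry (suc n) (+-mono-≤ (a≥0 zero) (+≤+ z≤n)) (proj₁ (b-digit zero)) (proj₂ (b-digit zero)) split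
    where
    split : (a zero + + q) * + (x ^ suc n) + + y * expansion x y n (a ∘ suc) C
          ≡ b zero * + (x ^ suc n) + + y * expansion x y n (b ∘ suc) C′
    split = begin
      (a zero + + q) * + (x ^ suc n) + + y * expansion x y n (a ∘ suc) C
        ≡⟨ regroup (a zero) (+ q) (+ (x ^ suc n)) (+ y * expansion x y n (a ∘ suc) C) ⟩
      (a zero * + (x ^ suc n) + + y * expansion x y n (a ∘ suc) C) + + q * + (x ^ suc n)
        ≡⟨ cong (_+ + q * + (x ^ suc n)) (expansion-suc x y n a C) ⟨
      expansion x y (suc n) a C + + q * + (x ^ suc n)
        ≡⟨ eq ⟩
      expansion x y (suc n) b C′
        ≡⟨ expansion-suc x y n b C′ ⟩
      b zero * + (x ^ suc n) + + y * expansion x y n (b ∘ suc) C′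
        ∎
      where
      open ≡-Reasoning
      regroup : ∀ a q X V → (a + q) * X + V ≡ (a * X + V) + q * X
      regroup = solve-∀
  ... | q′ , carried =
    expansion-top-≤ n (a ∘ suc) (b ∘ suc) (a≥0 ∘ suc) (b-digit ∘ suc) (q′ ℕ.* x)
      (trans (cong (_+_ (expansion x y n (a ∘ suc) C)) xⁿ⁺¹-as-xⁿ) carried)
    where
    xⁿ⁺¹-as-xⁿ : + (q′ ℕ.* x) * + (x ^ n) ≡ + q′ * + (x ^ suc n)
    xⁿ⁺¹-as-xⁿ = trans (sym (pos-* (q′ ℕ.* x) (x ^ n)))
                       (trans (cong +_ (ℕ.*-assoc q′ x (x ^ n))) (pos-* q′ (x ^ suc n)))

+-multiples-∸ : ∀ {k k′} → k ℕ.≤ k′ → ∀ v F → v + + k * F + + (k′ ∸ k) * F ≡ v + + k′ * F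
+-multiples-∸ {k} {k′} k≤k′ v F = begin
  v + + k * F + + (k′ ∸ k) * F      ≡⟨ collect v (+ k) (+ (k′ ∸ k)) F ⟩
  v + (+ k + + (k′ ∸ k)) * F        ≡⟨ cong (λ t → v + t * F) (pos-+ k (k′ ∸ k)) ⟨
  v + + (k ℕ.+ (k′ ∸ k)) * F        ≡⟨ cong (λ t → v + + t * F) (ℕ.m+[n∸m]≡n k≤k′) ⟩
  v + + k′ * F                      ∎
  where
  open ≡-Reasoning
  collect : ∀ v k m F → v + k * F + m * F ≡ v + (k + m) * F
  collect = solve-∀

lemma7 : (n x y : ℕ) → n Data.Nat.≥ 1 → Coprime x y → x Data.Nat.≥ 1 → x Data.Nat.< y →
    (v k k′ : ℕ) → k Data.Nat.≤ k′ →
    (c c′ : Fin (suc (suc n)) → ℤ) →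
    IsStableDecomp x y n (+ v + + k * F x y n) c →
    IsStableDecomp x y n (+ v + + k′ * F x y n) c′ →
    c (last n) ≤ c′ (last n)
lemma7 n x y _ coprime _ _ v k k′ k≤k′ c c′ (c-digits , _ , c-sum) (c′-digits , _ , c′-sum) =
  expansion-top-≤ (ℕ.sym coprime) (suc n) (λ i → c (inject₁ i) + + m) (c′ ∘ inject₁)
    (λ i → +-mono-≤ (proj₁ (c-digits i)) (+≤+ z≤n)) c′-digits 0 (begin
      expansion x y (suc n) (λ i → c (inject₁ i) + + m) (c (last n)) + 0ℤ
        ≡⟨ +-identityʳ _ ⟩
      expansion x y (suc n) (λ i → c (inject₁ i) + + m) (c (last n))
        ≡⟨ expansion-shift x y n (c ∘ inject₁) (c (last n)) _ m c-sum ⟩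
      + x * (+ v + + k * F x y n + + m * F x y n)
        ≡⟨ cong (+ x *_) (+-multiples-∸ k≤k′ (+ v) (F x y n)) ⟩
      + x * (+ v + + k′ * F x y n)
        ≡⟨ c′-sum ⟩
      + x * weightedSum x y n (c′ ∘ inject₁) + c′ (last n) * + (y ^ suc n)
        ≡⟨ cong (_+ c′ (last n) * + (y ^ suc n)) (weightedSum-exponent-suc x y n (c′ ∘ inject₁)) ⟨
      expansion x y (suc n) (c′ ∘ inject₁) (c′ (last n))
        ∎)
  where
  open ≡-Reasoning
  m = k′ ∸ k
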